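{- For any $w_1\in\mathcal{H}^0$ and $w_2\in\mathcal{H}^{\ge2}$, \[ Z^{\diamondsuit}(w_1\ast w_2)=Z^{\diamondsuit}(w_1)\,Z^{\diamondsuit}(w_2), \] where the right-hand side is the componentwise product in $\mathbb{Q}^{\mathbb{N}}$.
   Context: $[n]=\{1,\dots,n\}$. An index $\boldsymbol{k}=(k_1,\dots,k_r)$ of positive integers is admissible if $k_r\ge2$. For $N\in\mathbb{N}$ and admissible $\boldsymbol{k}$: $[r]^1_{\boldsymbol{k}}=\{i\mid k_i=1\}$, $S_{r,N}(A)=\{(n_1,\dots,n_r)\in[N-1]^r\mid n_i\le n_{i+1}\ (i\in A),\ n_i<n_{i+1}\ (i\in[r-1]\setminus A)\}$, \[ \zeta^{\diamondsuit}_N(\boldsymbol{k})=\sum_{A\subset[r]^1_{\boldsymbol{k}}}\sum_{(n_i)\in S_{r,N}(A)}\prod_{i\in A}\frac{1}{N-n_i}\prod_{i\in[r]\setminus A}\frac{1}{n_i^{k_i}}, \] $\zeta^{\diamondsuit}(\boldsymbol{k})=(\zeta^{\diamondsuit}_N(\boldsymbol{k}))_N\in\mathbb{Q}^{\mathbb{N}}$. $\mathcal{H}=\mathbb{Q}\langle x,y\rangle$, $\mathcal{H}^1=\mathbb{Q}+y\mathcal{H}$, $\mathcal{H}^0=\mathbb{Q}+y\mathcal{H}x$, $\mathcal{H}^{\ge2}=\mathbb{Q}+yx\,\mathbb{Q}\langle x,yx\rangle$, $e_k=yx^{k-1}$. $Z^{\diamondsuit}\colon\mathcal{H}^0\to\mathbb{Q}^{\mathbb{N}}$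 is $\mathbb{Q}$-linear with $Z^{\diamondsuit}(1)=1$, $Z^{\diamondsuit}(e_{k_1}\cdots e_{k_r})=\zeta^{\diamondsuit}(k_1,\dots,k_r)$ for admissible indices. The harmonic product $\ast$ on $\mathcal{H}^1$ is $\mathbb{Q}$-bilinear with $w\ast1=1\ast w=w$ and $w_1e_{k_1}\ast w_2e_{k_2}=(w_1\ast w_2e_{k_2})e_{k_1}+(w_1e_{k_1}\ast w_2)e_{k_2}+(w_1\ast w_2)e_{k_1+k_2}$ for words $w_1,w_2\in\mathcal{H}^1$. -}

module Defs where

open import Data.Bool using (Bool; true; false; if_then_else_; _∧_)
open import Data.Nat as ℕ using (ℕ; zero; suc; _∸_; _≤ᵇ_; _^_)
open import Data.Integer using (+_)
open import Data.Rational using (ℚ; _/_; 0ℚ; 1ℚ) renaming (_+_ to _+ℚ_; _*_ to _*ℚ_)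
open import Data.List using (List; []; _∷_; _++_; map; concatMap; upTo; reverse; foldr)
open import Data.List.Relation.Unary.All using (All)
open import Data.Product using (_×_; _,_)

-- A word e_{k₁} ⋯ e_{k_r} in H¹ is represented by the list (k₁ , … , k_r) of
-- positive integers (read left to right, as in the paper).
Word : Set
Word = List ℕ

Poly : Set
Poly = List (ℚ × Word)

Positive : ℕ → Set
Positive k = 1 ℕ.≤ k

data InH0 : Word → Set where
  empty : InH0 []
  admissible : ∀ (ks : List ℕ) (k : ℕ) → All Positive ks → 2 ℕ.≤ k → InH0 (ks Data.List.∷ʳ k)

-- all letters ≥ 2 (spans H^{≥2} = ℚ + yx ℚ⟨x, yx⟩)
InH≥2 : Word → Set
InH≥2 w = All (λ k → 2 ℕ.≤ k) w

InH0-poly : Poly → Set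
InH0-poly p = All (λ t → InH0 (Data.Product.proj₂ t)) p

InH≥2-poly : Poly → Set
InH≥2-poly p = All (λ t → InH≥2 (Data.Product.proj₂ t)) p

-- On reversed words (last letter first) the defining
-- recursion  w₁e_a ∗ w₂e_b = (w₁ ∗ w₂e_b)e_a + (w₁e_a ∗ w₂)e_b + (w₁ ∗ w₂)e_{a+b}
-- is structural.

harmRev : Word → Word → List Word
harmRev [] v = v ∷ []
harmRev (a ∷ u) [] = (a ∷ u) ∷ []
harmRev (a ∷ u) (b ∷ v) =
  map (a ∷_) (harmRev u (b ∷ v)) ++
  map (b ∷_) (harmRev (a ∷ u) v) ++
  map ((a ℕ.+ b) ∷_) (harmRev u v)

harmWord : Word → Word → List Word
harmWord u v = map reverse (harmRev (reverse u) (reverse v))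

_∗_ : Poly → Poly → Poly
p ∗ q = concatMap (λ { (c , u) → concatMap (λ { (d , v) →
          map (λ w → (c *ℚ d , w)) (harmWord u v) }) q }) p

-- 1/m as a rational (only used for m ≥ 1; 1/0 := 0 is never reached)
inv : ℕ → ℚ
inv zero = 0ℚ
inv (suc m) = (+ 1) / suc m

sumℚ : List ℚ → ℚ
sumℚ = foldr _+ℚ_ 0ℚ

-- all subsets A ⊆ [r]¹_k, as boolean masks (true at i ⇔ i ∈ A)
subsets : List ℕ → List (List Bool)
subsets [] = [] ∷ []
subsets (k ∷ ks) =
  concatMap (λ A → (if k ℕ.≡ᵇ 1 then (false ∷ A) ∷ (true ∷ A) ∷ [] else (false ∷ A) ∷ [])) (subsets ks)

tuples : ℕ → ℕ → List (List ℕ)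
tuples zero N = [] ∷ []
tuples (suc r) N = concatMap (λ t → map (_∷ t) (map suc (upTo (N ∸ 1)))) (tuples r N)

inS : List Bool → List ℕ → Bool
inS (a ∷ as) (m ∷ n ∷ ns) = (if a then m ≤ᵇ n else suc m ≤ᵇ n) ∧ inS as (n ∷ ns)
inS _ _ = true

weight : ℕ → List ℕ → List Bool → List ℕ → ℚ
weight N (k ∷ ks) (a ∷ as) (n ∷ ns) =
  (if a then inv (N ∸ n) else inv (n ^ k)) *ℚ weight N ks as ns
weight N _ _ _ = 1ℚ

ζ♢ : Word → ℕ → ℚ
ζ♢ ks N = sumℚ (concatMap (λ A → concatMap (λ ns →
            if inS A ns then weight N ks A ns ∷ [] else []) (tuples (Data.List.length ks) N))
          (subsets ks))

Zword : Word → ℕ → ℚ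
Zword [] N = 1ℚ
Zword (k ∷ ks) N = ζ♢ (k ∷ ks) N

Z♢ : Poly → ℕ → ℚ
Z♢ p N = sumℚ (map (λ { (c , w) → c *ℚ Zword w N }) p)

-- Expanding the subsets A ⊆ [r]¹_k, ζ^♢_N(k) becomes a sum of nested sums, over indices in
-- [1, N − 1], of words in two kinds of letters (see Letter).  When every letter of w₂ is at
-- least 2, its expansion is a single word of strict letters.  Splitting both factors by their
-- smallest index shows that the product of a nested sum with a strict one is the sum of the
-- nested sums over the quasi-shuffle ⊛, in which weak letters never merge.  Writing ∗ by
-- recursion on first letters (harm), the expansion of w₁ ∗ w₂ is, term by term, the ⊛-product
-- of the expansion of w₁ with w₂.
module Submission where

open import Defs
open import Data.Bool using (Bool; true; false; if_then_else_; _∧_; T)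
open import Data.Empty using (⊥-elim)
import Data.Integer as ℤ
open import Data.List using (List; []; _∷_; _++_; _∷ʳ_; map; concatMap; reverse; upTo; applyUpTo; length)
import Data.List.Properties as List
open import Data.List.Relation.Unary.All using (All; []; _∷_)
open import Data.Nat as ℕ using (ℕ; zero; suc; _≤_; s≤s; z≤n; _∸_; _^_)
import Data.Nat.Properties as ℕ
open import Data.Product using (_×_; _,_)
open import Data.Rational using (ℚ; 0ℚ; 1ℚ; _+_; _*_)
import Data.Rational.Properties as ℚ
open import Data.Rational.Unnormalised using (mkℚᵘ)
import Data.Rational.Unnormalised.Properties as ℚᵘ
open import Data.Sum using (inj₁; inj₂)
open import Data.Unit using (tt)
open import Function using (_∘_)
open import Level using (0ℓ)
open import Relation.Binary.PropositionalEquality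
open import Relation.Nullary using (¬_)
open import Relation.Nullary.Decidable using (dec⇒maybe)
import Tactic.RingSolver.Core.AlmostCommutativeRing as ACR
open import Tactic.RingSolver using (solve-∀)
open ≡-Reasoning

private variable
  A B : Set

ℚ-ring : ACR.AlmostCommutativeRing 0ℓ 0ℓ
ℚ-ring = ACR.fromCommutativeRing ℚ.+-*-commutativeRing (λ q → dec⇒maybe (0ℚ ℚ.≟ q))

+-interchange : ∀ a b c d → (a + b) + (c + d) ≡ (a + c) + (b + d)
+-interchange = solve-∀ ℚ-ring

*-interchange : ∀ a b c d → (a * b) * (c * d) ≡ (a * c) * (b * d)
*-interchange = solve-∀ ℚ-ring

∑ : List A → (A → ℚ) → ℚ
∑ xs f = sumℚ (map f xs)

syntax ∑ xs (λ x → e) = ∑[ x ∈ xs ] e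

[_]·_ : Bool → ℚ → ℚ
[ b ]· q = if b then q else 0ℚ

[]·-true : ∀ {b} q → T b → [ b ]· q ≡ q
[]·-true {true} q _ = refl

[]·-false : ∀ {b} q → ¬ T b → [ b ]· q ≡ 0ℚ
[]·-false {false} q _  = refl
[]·-false {true}  q ¬t = ⊥-elim (¬t tt)

[]·-∧-* : ∀ b c w q → [ b ∧ c ]· (w * q) ≡ [ b ]· (w * [ c ]· q)
[]·-∧-* true  true  w q = refl
[]·-∧-* true  false w q = sym (ℚ.*-zeroʳ w)
[]·-∧-* false c     w q = refl

sumℚ-++ : (ps qs : List ℚ) → sumℚ (ps ++ qs) ≡ sumℚ ps + sumℚ qs
sumℚ-++ []       qs = sym (ℚ.+-identityˡ _)
sumℚ-++ (p ∷ ps) qs = trans (cong (p +_) (sumℚ-++ ps qs)) (sym (ℚ.+-assoc p _ _))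

sumℚ-concatMap : (f : A → List ℚ) (xs : List A) → sumℚ (concatMap f xs) ≡ ∑[ x ∈ xs ] sumℚ (f x)
sumℚ-concatMap f []       = refl
sumℚ-concatMap f (x ∷ xs) = trans (sumℚ-++ (f x) _) (cong (sumℚ (f x) +_) (sumℚ-concatMap f xs))

∑-++ : (xs ys : List A) (f : A → ℚ) → ∑ (xs ++ ys) f ≡ ∑ xs f + ∑ ys f
∑-++ xs ys f = trans (cong sumℚ (List.map-++ f xs ys)) (sumℚ-++ (map f xs) (map f ys))

∑-map : (g : A → B) (xs : List A) (f : B → ℚ) → ∑ (map g xs) f ≡ ∑ xs (f ∘ g)
∑-map g xs f = cong sumℚ (sym (List.map-∘ xs))

∑-concatMap : (g : A → List B) (xs : List A) (f : B → ℚ) →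
              ∑ (concatMap g xs) f ≡ ∑[ x ∈ xs ] ∑ (g x) f
∑-concatMap g []       f = refl
∑-concatMap g (x ∷ xs) f = trans (∑-++ (g x) _ f) (cong (∑ (g x) f +_) (∑-concatMap g xs f))

∑-cong : (xs : List A) {f g : A → ℚ} → (∀ x → f x ≡ g x) → ∑ xs f ≡ ∑ xs g
∑-cong xs f≗g = cong sumℚ (List.map-cong f≗g xs)

∑-cong-All : {P : A → Set} {xs : List A} → All P xs →
             {f g : A → ℚ} → (∀ x → P x → f x ≡ g x) → ∑ xs f ≡ ∑ xs g
∑-cong-All []         f≗g = refl
∑-cong-All (px ∷ pxs) f≗g = cong₂ _+_ (f≗g _ px) (∑-cong-All pxs f≗g)

∑-zero : (xs : List A) → ∑[ x ∈ xs ] 0ℚ ≡ 0ℚ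
∑-zero []       = refl
∑-zero (x ∷ xs) = trans (ℚ.+-identityˡ _) (∑-zero xs)

∑-+ : (xs : List A) (f g : A → ℚ) → ∑[ x ∈ xs ] (f x + g x) ≡ ∑ xs f + ∑ xs g
∑-+ []       f g = sym (ℚ.+-identityˡ 0ℚ)
∑-+ (x ∷ xs) f g = trans (cong (f x + g x +_) (∑-+ xs f g)) (+-interchange (f x) (g x) _ _)

∑-*ˡ : (xs : List A) (c : ℚ) (f : A → ℚ) → ∑[ x ∈ xs ] (c * f x) ≡ c * ∑ xs f
∑-*ˡ []       c f = sym (ℚ.*-zeroʳ c)
∑-*ˡ (x ∷ xs) c f = trans (cong (c * f x +_) (∑-*ˡ xs c f)) (sym (ℚ.*-distribˡ-+ c (f x) _))

∑-*ʳ : (xs : List A) (c : ℚ) (f : A → ℚ) → ∑[ x ∈ xs ] (f x * c) ≡ ∑ xs f * c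
∑-*ʳ xs c f = trans (∑-cong xs (λ x → ℚ.*-comm (f x) c)) (trans (∑-*ˡ xs c f) (ℚ.*-comm c _))

∑-affine : (xs : List A) (c : ℚ) (f g : A → ℚ) → ∑[ x ∈ xs ] (c * f x + g x) ≡ c * ∑ xs f + ∑ xs g
∑-affine xs c f g = trans (∑-+ xs (λ x → c * f x) g) (cong (_+ ∑ xs g) (∑-*ˡ xs c f))

∑-[]· : (xs : List A) (b : Bool) (f : A → ℚ) → ∑[ x ∈ xs ] [ b ]· f x ≡ [ b ]· ∑ xs f
∑-[]· xs true  f = refl
∑-[]· xs false f = ∑-zero xs

∑-comm : (xs : List A) (ys : List B) (f : A → B → ℚ) →
         ∑[ x ∈ xs ] ∑[ y ∈ ys ] f x y ≡ ∑[ y ∈ ys ] ∑[ x ∈ xs ] f x y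
∑-comm []       ys f = sym (∑-zero ys)
∑-comm (x ∷ xs) ys f = trans (cong (∑ ys (f x) +_) (∑-comm xs ys f)) (sym (∑-+ ys (f x) _))

∑-map₂ : (f g : A → B) (xs ys : List A) (F : B → ℚ) →
         ∑ (map f xs ++ map g ys) F ≡ ∑ xs (F ∘ f) + ∑ ys (F ∘ g)
∑-map₂ f g xs ys F = trans (∑-++ (map f xs) _ F) (cong₂ _+_ (∑-map f xs F) (∑-map g ys F))

∑-map₃ : (f g h : A → B) (xs ys zs : List A) (F : B → ℚ) →
         ∑ (map f xs ++ map g ys ++ map h zs) F ≡ ∑ xs (F ∘ f) + (∑ ys (F ∘ g) + ∑ zs (F ∘ h))
∑-map₃ f g h xs ys zs F =
  trans (∑-++ (map f xs) _ F) (cong₂ _+_ (∑-map f xs F) (∑-map₂ g h ys zs F))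

-- The index (k₁, …, k_r) and a subset A ⊆ [r]¹_k are encoded together as a word in
-- these letters: strict kᵢ for i ∉ A (weight 1/nᵢ^kᵢ, nᵢ < nᵢ₊₁) and weak for i ∈ A
-- (weight 1/(N − nᵢ), nᵢ ≤ nᵢ₊₁).
data Letter : Set where
  strict : ℕ → Letter
  weak   : Letter

-- A weak letter is never contracted with a strict one: equal indices are already
-- counted in the branch where the weak letter comes first.
infixr 5 _⊛_
_⊛_ : List Letter → List ℕ → List (List Letter)
[]             ⊛ v       = map strict v ∷ []
x@(_ ∷ _)      ⊛ []      = x ∷ []
(strict a ∷ x) ⊛ (b ∷ v) = map (strict a ∷_) (x ⊛ (b ∷ v))
                        ++ map (strict b ∷_) ((strict a ∷ x) ⊛ v)
                        ++ map (strict (a ℕ.+ b) ∷_) (x ⊛ v)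
(weak ∷ x)     ⊛ (b ∷ v) = map (weak ∷_) (x ⊛ (b ∷ v))
                        ++ map (strict b ∷_) ((weak ∷ x) ⊛ v)

⊛-[] : ∀ x → x ⊛ [] ≡ x ∷ []
⊛-[] []      = refl
⊛-[] (_ ∷ _) = refl

∑-strict-⊛ : ∀ a x b v (G : List Letter → ℚ) → ∑ ((strict a ∷ x) ⊛ (b ∷ v)) G ≡
  ∑[ y ∈ x ⊛ (b ∷ v) ] G (strict a ∷ y)
    + (∑[ y ∈ (strict a ∷ x) ⊛ v ] G (strict b ∷ y) + ∑[ y ∈ x ⊛ v ] G (strict (a ℕ.+ b) ∷ y))
∑-strict-⊛ a x b v =
  ∑-map₃ (strict a ∷_) (strict b ∷_) (strict (a ℕ.+ b) ∷_) (x ⊛ (b ∷ v)) ((strict a ∷ x) ⊛ v) (x ⊛ v)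

∑-weak-⊛ : ∀ x b v (G : List Letter → ℚ) → ∑ ((weak ∷ x) ⊛ (b ∷ v)) G ≡
  ∑[ y ∈ x ⊛ (b ∷ v) ] G (weak ∷ y) + ∑[ y ∈ (weak ∷ x) ⊛ v ] G (strict b ∷ y)
∑-weak-⊛ x b v = ∑-map₂ (weak ∷_) (strict b ∷_) (x ⊛ (b ∷ v)) ((weak ∷ x) ⊛ v)

strict-product-expand : ∀ a x x′ b y y′ → (a * x + x′) * (b * y + y′) ≡
  (a * (x * y′) + (b * (x′ * y) + (a * b) * (x * y))) + x′ * y′
strict-product-expand = solve-∀ ℚ-ring

weak-product-expand : ∀ c z x′ b y y′ → (c * z + x′) * (b * y + y′) ≡
  c * (z * (b * y + y′)) + (b * (x′ * y) + x′ * y′)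
weak-product-expand = solve-∀ ℚ-ring

+-interchange₃ : ∀ a₁ a₂ a₃ b₁ b₂ b₃ →
  (a₁ + (a₂ + a₃)) + (b₁ + (b₂ + b₃)) ≡ (a₁ + b₁) + ((a₂ + b₂) + (a₃ + b₃))
+-interchange₃ = solve-∀ ℚ-ring

+-reassoc : ∀ a b c d → a + (b + (c + d)) ≡ (a + c) + (b + d)
+-reassoc = solve-∀ ℚ-ring

-- Nested sums over an arbitrary finite chain, given as the list ns of its elements in increasing order.
module NestedSum {I : Set} (pw : ℕ → I → ℚ) (cw : I → ℚ) where

  nested : List Letter → List I → ℚ
  nested []             ns       = 1ℚ
  nested (_ ∷ _)        []       = 0ℚ
  nested (strict k ∷ x) (n ∷ ns) = pw k n * nested x ns + nested (strict k ∷ x) ns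
  nested (weak ∷ x)     (n ∷ ns) = cw n * nested x (n ∷ ns) + nested (weak ∷ x) ns

  ∑-nested-strict : ∀ k n ns P → ∑[ y ∈ P ] nested (strict k ∷ y) (n ∷ ns) ≡
                    pw k n * ∑[ y ∈ P ] nested y ns + ∑[ y ∈ P ] nested (strict k ∷ y) ns
  ∑-nested-strict k n ns P = ∑-affine P (pw k n) _ _

  ∑-nested-weak : ∀ n ns P → ∑[ y ∈ P ] nested (weak ∷ y) (n ∷ ns) ≡
                  cw n * ∑[ y ∈ P ] nested y (n ∷ ns) + ∑[ y ∈ P ] nested (weak ∷ y) ns
  ∑-nested-weak n ns P = ∑-affine P (cw n) _ _

  module _ (pw-+ : ∀ a b n → pw (a ℕ.+ b) n ≡ pw a n * pw b n) where

    nested-⊛ : ∀ ns x v → nested x ns * nested (map strict v) ns ≡ ∑[ y ∈ x ⊛ v ] nested y ns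
    nested-⊛ ns []      v  = trans (ℚ.*-identityˡ V) (sym (ℚ.+-identityʳ V))
      where
      V : ℚ
      V = nested (map strict v) ns
    nested-⊛ ns (l ∷ x) [] = trans (ℚ.*-identityʳ X) (sym (ℚ.+-identityʳ X))
      where
      X : ℚ
      X = nested (l ∷ x) ns
    nested-⊛ [] (strict a ∷ x) (b ∷ v) = sym (begin
      ∑[ y ∈ (strict a ∷ x) ⊛ (b ∷ v) ] nested y []
        ≡⟨ ∑-strict-⊛ a x b v _ ⟩
      ∑[ y ∈ x ⊛ (b ∷ v) ] 0ℚ + (∑[ y ∈ (strict a ∷ x) ⊛ v ] 0ℚ + ∑[ y ∈ x ⊛ v ] 0ℚ)
        ≡⟨ cong₂ _+_ (∑-zero (x ⊛ (b ∷ v)))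
                     (cong₂ _+_ (∑-zero ((strict a ∷ x) ⊛ v)) (∑-zero (x ⊛ v))) ⟩
      0ℚ + (0ℚ + 0ℚ)
        ≡⟨⟩
      0ℚ * nested (map strict (b ∷ v)) [] ∎)
    nested-⊛ [] (weak ∷ x) (b ∷ v) = sym (begin
      ∑[ y ∈ (weak ∷ x) ⊛ (b ∷ v) ] nested y []
        ≡⟨ ∑-weak-⊛ x b v _ ⟩
      ∑[ y ∈ x ⊛ (b ∷ v) ] 0ℚ + ∑[ y ∈ (weak ∷ x) ⊛ v ] 0ℚ
        ≡⟨ cong₂ _+_ (∑-zero (x ⊛ (b ∷ v))) (∑-zero ((weak ∷ x) ⊛ v)) ⟩
      0ℚ + 0ℚ
        ≡⟨⟩
      0ℚ * nested (map strict (b ∷ v)) [] ∎)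
    nested-⊛ (n ∷ ns) (strict a ∷ x) (b ∷ v) = begin
      (pw a n * X + X₁) * (pw b n * V + V₁)
        ≡⟨ strict-product-expand (pw a n) X X₁ (pw b n) V V₁ ⟩
      (pw a n * (X * V₁) + (pw b n * (X₁ * V) + (pw a n * pw b n) * (X * V))) + X₁ * V₁
        ≡⟨ cong₂ _+_ (cong₂ _+_ (cong (pw a n *_) (nested-⊛ ns x (b ∷ v)))
                                (cong₂ _+_ (cong (pw b n *_) (nested-⊛ ns (strict a ∷ x) v))
                                           (cong₂ _*_ (sym (pw-+ a b n)) (nested-⊛ ns x v))))
                     (trans (nested-⊛ ns (strict a ∷ x) (b ∷ v)) (∑-strict-⊛ a x b v _)) ⟩
      (pw a n * Σ₁ + (pw b n * Σ₂ + pw (a ℕ.+ b) n * Σ₃)) + (Σ₁′ + (Σ₂′ + Σ₃′))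
        ≡⟨ +-interchange₃ (pw a n * Σ₁) (pw b n * Σ₂) (pw (a ℕ.+ b) n * Σ₃) Σ₁′ Σ₂′ Σ₃′ ⟩
      (pw a n * Σ₁ + Σ₁′) + ((pw b n * Σ₂ + Σ₂′) + (pw (a ℕ.+ b) n * Σ₃ + Σ₃′))
        ≡⟨ cong₂ _+_ (∑-nested-strict a n ns P₁)
                     (cong₂ _+_ (∑-nested-strict b n ns P₂) (∑-nested-strict (a ℕ.+ b) n ns P₃)) ⟨
      ∑[ y ∈ P₁ ] nested (strict a ∷ y) (n ∷ ns)
        + (∑[ y ∈ P₂ ] nested (strict b ∷ y) (n ∷ ns)
          + ∑[ y ∈ P₃ ] nested (strict (a ℕ.+ b) ∷ y) (n ∷ ns))
        ≡⟨ ∑-strict-⊛ a x b v _ ⟨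
      ∑[ y ∈ (strict a ∷ x) ⊛ (b ∷ v) ] nested y (n ∷ ns) ∎
      where
      X X₁ V V₁ Σ₁ Σ₂ Σ₃ Σ₁′ Σ₂′ Σ₃′ : ℚ
      P₁ P₂ P₃ : List (List Letter)
      X  = nested x ns
      X₁ = nested (strict a ∷ x) ns
      V  = nested (map strict v) ns
      V₁ = nested (map strict (b ∷ v)) ns
      P₁ = x ⊛ (b ∷ v)
      P₂ = (strict a ∷ x) ⊛ v
      P₃ = x ⊛ v
      Σ₁ = ∑[ y ∈ P₁ ] nested y ns
      Σ₂ = ∑[ y ∈ P₂ ] nested y ns
      Σ₃ = ∑[ y ∈ P₃ ] nested y ns
      Σ₁′ = ∑[ y ∈ P₁ ] nested (strict a ∷ y) ns
      Σ₂′ = ∑[ y ∈ P₂ ] nested (strict b ∷ y) ns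
      Σ₃′ = ∑[ y ∈ P₃ ] nested (strict (a ℕ.+ b) ∷ y) ns
    nested-⊛ (n ∷ ns) (weak ∷ x) (b ∷ v) = begin
      (cw n * Y + X₁) * (pw b n * V + V₁)
        ≡⟨ weak-product-expand (cw n) Y X₁ (pw b n) V V₁ ⟩
      cw n * (Y * (pw b n * V + V₁)) + (pw b n * (X₁ * V) + X₁ * V₁)
        ≡⟨ cong₂ _+_ (cong (cw n *_) (nested-⊛ (n ∷ ns) x (b ∷ v)))
                     (cong₂ _+_ (cong (pw b n *_) (nested-⊛ ns (weak ∷ x) v))
                                (trans (nested-⊛ ns (weak ∷ x) (b ∷ v)) (∑-weak-⊛ x b v _))) ⟩
      cw n * Σ₁ + (pw b n * Σ₂ + (Σ₁′ + Σ₂′))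
        ≡⟨ +-reassoc (cw n * Σ₁) (pw b n * Σ₂) Σ₁′ Σ₂′ ⟩
      (cw n * Σ₁ + Σ₁′) + (pw b n * Σ₂ + Σ₂′)
        ≡⟨ cong₂ _+_ (∑-nested-weak n ns P₁) (∑-nested-strict b n ns P₂) ⟨
      ∑[ y ∈ P₁ ] nested (weak ∷ y) (n ∷ ns) + ∑[ y ∈ P₂ ] nested (strict b ∷ y) (n ∷ ns)
        ≡⟨ ∑-weak-⊛ x b v _ ⟨
      ∑[ y ∈ (weak ∷ x) ⊛ (b ∷ v) ] nested y (n ∷ ns) ∎
      where
      Y X₁ V V₁ Σ₁ Σ₂ Σ₁′ Σ₂′ : ℚ
      P₁ P₂ : List (List Letter)
      Y  = nested x (n ∷ ns)
      X₁ = nested (weak ∷ x) ns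
      V  = nested (map strict v) ns
      V₁ = nested (map strict (b ∷ v)) ns
      P₁ = x ⊛ (b ∷ v)
      P₂ = (weak ∷ x) ⊛ v
      Σ₁ = ∑[ y ∈ P₁ ] nested y (n ∷ ns)
      Σ₂ = ∑[ y ∈ P₂ ] nested y ns
      Σ₁′ = ∑[ y ∈ P₁ ] nested (weak ∷ y) ns
      Σ₂′ = ∑[ y ∈ P₂ ] nested (strict b ∷ y) ns

-- The harmonic product by recursion on first letters, which is how nested sums split.
harm : List ℕ → List ℕ → List (List ℕ)
harm []        v       = v ∷ []
harm u@(_ ∷ _) []      = u ∷ []
harm (a ∷ u)   (b ∷ v) = map (a ∷_) (harm u (b ∷ v))
                      ++ map (b ∷_) (harm (a ∷ u) v)
                      ++ map ((a ℕ.+ b) ∷_) (harm u v)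

∑-harm-[] : ∀ u (G : List ℕ → ℚ) → ∑ (harm u []) G ≡ G u + 0ℚ
∑-harm-[] []      G = refl
∑-harm-[] (_ ∷ _) G = refl

∑-harm-∷ : ∀ a u b v (G : List ℕ → ℚ) → ∑ (harm (a ∷ u) (b ∷ v)) G ≡
  ∑[ w ∈ harm u (b ∷ v) ] G (a ∷ w)
    + (∑[ w ∈ harm (a ∷ u) v ] G (b ∷ w) + ∑[ w ∈ harm u v ] G ((a ℕ.+ b) ∷ w))
∑-harm-∷ a u b v = ∑-map₃ (a ∷_) (b ∷_) ((a ℕ.+ b) ∷_) (harm u (b ∷ v)) (harm (a ∷ u) v) (harm u v)

transpose₃ : ∀ x₁ x₂ x₃ y₁ y₂ y₃ z₁ z₂ z₃ →
  (x₁ + (x₂ + x₃)) + ((y₁ + (y₂ + y₃)) + (z₁ + (z₂ + z₃))) ≡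
  (x₁ + (y₁ + z₁)) + ((x₂ + (y₂ + z₂)) + (x₃ + (y₃ + z₃)))
transpose₃ = solve-∀ ℚ-ring

∑-harm-∷ʳ : ∀ u v a b (F : List ℕ → ℚ) → ∑ (harm (u ∷ʳ a) (v ∷ʳ b)) F ≡
  ∑[ w ∈ harm u (v ∷ʳ b) ] F (w ∷ʳ a)
    + (∑[ w ∈ harm (u ∷ʳ a) v ] F (w ∷ʳ b) + ∑[ w ∈ harm u v ] F (w ∷ʳ (a ℕ.+ b)))
∑-harm-∷ʳ [] [] a b F = rearrange (F (a ∷ b ∷ [])) (F (b ∷ a ∷ [])) (F ((a ℕ.+ b) ∷ []))
  where
  rearrange : ∀ x y z → x + (y + (z + 0ℚ)) ≡ (y + 0ℚ) + ((x + 0ℚ) + (z + 0ℚ))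
  rearrange = solve-∀ ℚ-ring
∑-harm-∷ʳ [] (d ∷ v) a b F = begin
  ∑ (harm (a ∷ []) (d ∷ v ∷ʳ b)) F
    ≡⟨ ∑-harm-∷ a [] d (v ∷ʳ b) F ⟩
  Sₐ + (∑ (harm (a ∷ []) (v ∷ʳ b)) (F ∘ (d ∷_)) + S₊)
    ≡⟨ cong (λ s → Sₐ + (s + S₊)) (∑-harm-∷ʳ [] v a b (F ∘ (d ∷_))) ⟩
  Sₐ + ((B₁ + (B₂ + B₃)) + S₊)
    ≡⟨ rearrange Sₐ B₁ B₂ B₃ S₊ ⟩
  B₁ + ((Sₐ + (B₂ + S₊)) + B₃)
    ≡⟨ cong (λ s → B₁ + (s + B₃)) (∑-harm-∷ a [] d v (F ∘ (_∷ʳ b))) ⟨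
  B₁ + (∑ (harm (a ∷ []) (d ∷ v)) (F ∘ (_∷ʳ b)) + B₃) ∎
  where
  Sₐ S₊ B₁ B₂ B₃ : ℚ
  Sₐ = F (a ∷ d ∷ v ∷ʳ b) + 0ℚ
  S₊ = F ((a ℕ.+ d) ∷ v ∷ʳ b) + 0ℚ
  B₁ = F (d ∷ (v ∷ʳ b) ∷ʳ a) + 0ℚ
  B₂ = ∑[ w ∈ harm (a ∷ []) v ] F (d ∷ w ∷ʳ b)
  B₃ = F (d ∷ v ∷ʳ (a ℕ.+ b)) + 0ℚ
  rearrange : ∀ s b₁ b₂ b₃ t → s + ((b₁ + (b₂ + b₃)) + t) ≡ b₁ + ((s + (b₂ + t)) + b₃)
  rearrange = solve-∀ ℚ-ring
∑-harm-∷ʳ (c ∷ u) [] a b F = begin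
  ∑ (harm (c ∷ u ∷ʳ a) (b ∷ [])) F
    ≡⟨ ∑-harm-∷ c (u ∷ʳ a) b [] F ⟩
  ∑ (harm (u ∷ʳ a) (b ∷ [])) (F ∘ (c ∷_)) + (Q + ∑ (harm (u ∷ʳ a) []) (F ∘ ((c ℕ.+ b) ∷_)))
    ≡⟨ cong₂ (λ s t → s + (Q + t)) (∑-harm-∷ʳ u [] a b (F ∘ (c ∷_))) (∑-harm-[] (u ∷ʳ a) _) ⟩
  (P₁ + (∑[ w ∈ harm (u ∷ʳ a) [] ] F (c ∷ w ∷ʳ b) + ∑[ w ∈ harm u [] ] F (c ∷ w ∷ʳ (a ℕ.+ b))))
    + (Q + R)
    ≡⟨ cong₂ (λ s t → (P₁ + (s + t)) + (Q + R)) (∑-harm-[] (u ∷ʳ a) _) (∑-harm-[] u _) ⟩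
  (P₁ + (P₂ + P₃)) + (Q + R)
    ≡⟨ rearrange P₁ P₂ P₃ Q R ⟩
  (P₁ + (Q + R)) + (P₂ + P₃)
    ≡⟨ cong (λ s → (P₁ + (Q + s)) + (P₂ + P₃)) (∑-harm-[] u _) ⟨
  (P₁ + (Q + ∑ (harm u []) (F ∘ (_∷ʳ a) ∘ ((c ℕ.+ b) ∷_)))) + (P₂ + P₃)
    ≡⟨ cong (_+ (P₂ + P₃)) (∑-harm-∷ c u b [] (F ∘ (_∷ʳ a))) ⟨
  ∑ (harm (c ∷ u) (b ∷ [])) (F ∘ (_∷ʳ a)) + (P₂ + P₃) ∎
  where
  P₁ P₂ P₃ Q R : ℚ
  P₁ = ∑[ w ∈ harm u (b ∷ []) ] F (c ∷ w ∷ʳ a)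
  P₂ = F (c ∷ (u ∷ʳ a) ∷ʳ b) + 0ℚ
  P₃ = F (c ∷ u ∷ʳ (a ℕ.+ b)) + 0ℚ
  Q  = F (b ∷ c ∷ u ∷ʳ a) + 0ℚ
  R  = F ((c ℕ.+ b) ∷ u ∷ʳ a) + 0ℚ
  rearrange : ∀ p₁ p₂ p₃ q r → (p₁ + (p₂ + p₃)) + (q + r) ≡ (p₁ + (q + r)) + (p₂ + p₃)
  rearrange = solve-∀ ℚ-ring
∑-harm-∷ʳ (c ∷ u) (d ∷ v) a b F = begin
  ∑ (harm (c ∷ u ∷ʳ a) (d ∷ v ∷ʳ b)) F
    ≡⟨ ∑-harm-∷ c (u ∷ʳ a) d (v ∷ʳ b) F ⟩
  ∑ (harm (u ∷ʳ a) ((d ∷ v) ∷ʳ b)) (F ∘ (c ∷_))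
    + (∑ (harm ((c ∷ u) ∷ʳ a) (v ∷ʳ b)) (F ∘ (d ∷_))
      + ∑ (harm (u ∷ʳ a) (v ∷ʳ b)) (F ∘ ((c ℕ.+ d) ∷_)))
    ≡⟨ cong₂ _+_ (∑-harm-∷ʳ u (d ∷ v) a b (F ∘ (c ∷_)))
                 (cong₂ _+_ (∑-harm-∷ʳ (c ∷ u) v a b (F ∘ (d ∷_)))
                            (∑-harm-∷ʳ u v a b (F ∘ ((c ℕ.+ d) ∷_)))) ⟩
  (X₁ + (X₂ + X₃)) + ((Y₁ + (Y₂ + Y₃)) + (Z₁ + (Z₂ + Z₃)))
    ≡⟨ transpose₃ X₁ X₂ X₃ Y₁ Y₂ Y₃ Z₁ Z₂ Z₃ ⟩
  (X₁ + (Y₁ + Z₁)) + ((X₂ + (Y₂ + Z₂)) + (X₃ + (Y₃ + Z₃)))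
    ≡⟨ cong₂ _+_ (∑-harm-∷ c u d (v ∷ʳ b) (F ∘ (_∷ʳ a)))
                 (cong₂ _+_ (∑-harm-∷ c (u ∷ʳ a) d v (F ∘ (_∷ʳ b)))
                            (∑-harm-∷ c u d v (F ∘ (_∷ʳ (a ℕ.+ b))))) ⟨
  ∑ (harm (c ∷ u) ((d ∷ v) ∷ʳ b)) (F ∘ (_∷ʳ a))
    + (∑ (harm ((c ∷ u) ∷ʳ a) (d ∷ v)) (F ∘ (_∷ʳ b))
      + ∑ (harm (c ∷ u) (d ∷ v)) (F ∘ (_∷ʳ (a ℕ.+ b)))) ∎
  where
  X₁ X₂ X₃ Y₁ Y₂ Y₃ Z₁ Z₂ Z₃ : ℚ
  X₁ = ∑[ w ∈ harm u ((d ∷ v) ∷ʳ b) ] F (c ∷ w ∷ʳ a)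
  X₂ = ∑[ w ∈ harm (u ∷ʳ a) (d ∷ v) ] F (c ∷ w ∷ʳ b)
  X₃ = ∑[ w ∈ harm u (d ∷ v) ] F (c ∷ w ∷ʳ (a ℕ.+ b))
  Y₁ = ∑[ w ∈ harm (c ∷ u) (v ∷ʳ b) ] F (d ∷ w ∷ʳ a)
  Y₂ = ∑[ w ∈ harm ((c ∷ u) ∷ʳ a) v ] F (d ∷ w ∷ʳ b)
  Y₃ = ∑[ w ∈ harm (c ∷ u) v ] F (d ∷ w ∷ʳ (a ℕ.+ b))
  Z₁ = ∑[ w ∈ harm u (v ∷ʳ b) ] F ((c ℕ.+ d) ∷ w ∷ʳ a)
  Z₂ = ∑[ w ∈ harm (u ∷ʳ a) v ] F ((c ℕ.+ d) ∷ w ∷ʳ b)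
  Z₃ = ∑[ w ∈ harm u v ] F ((c ℕ.+ d) ∷ w ∷ʳ (a ℕ.+ b))

∑-harmRev : ∀ ru rv (F : List ℕ → ℚ) →
            ∑ (harmRev ru rv) (F ∘ reverse) ≡ ∑ (harm (reverse ru) (reverse rv)) F
∑-harmRev []       rv       F = refl
∑-harmRev (a ∷ ru) []       F = sym (∑-harm-[] (reverse (a ∷ ru)) F)
∑-harmRev (a ∷ ru) (b ∷ rv) F = begin
  ∑ (harmRev (a ∷ ru) (b ∷ rv)) (F ∘ reverse)
    ≡⟨ ∑-map₃ (a ∷_) (b ∷_) ((a ℕ.+ b) ∷_) (harmRev ru (b ∷ rv)) (harmRev (a ∷ ru) rv) (harmRev ru rv) _ ⟩
  ∑[ w ∈ harmRev ru (b ∷ rv) ] F (reverse (a ∷ w))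
    + (∑[ w ∈ harmRev (a ∷ ru) rv ] F (reverse (b ∷ w)) + ∑[ w ∈ harmRev ru rv ] F (reverse ((a ℕ.+ b) ∷ w)))
    ≡⟨ cong₂ _+_ (last-letter a ru (b ∷ rv))
                 (cong₂ _+_ (last-letter b (a ∷ ru) rv) (last-letter (a ℕ.+ b) ru rv)) ⟩
  ∑ (harm (reverse ru) (reverse (b ∷ rv))) (F ∘ (_∷ʳ a))
    + (∑ (harm (reverse (a ∷ ru)) (reverse rv)) (F ∘ (_∷ʳ b)) + Σ₊)
    ≡⟨ cong₂ (λ u v → ∑ (harm (reverse ru) v) (F ∘ (_∷ʳ a))
                      + (∑ (harm u (reverse rv)) (F ∘ (_∷ʳ b)) + Σ₊))
             (List.unfold-reverse a ru) (List.unfold-reverse b rv) ⟩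
  ∑ (harm (reverse ru) (reverse rv ∷ʳ b)) (F ∘ (_∷ʳ a))
    + (∑ (harm (reverse ru ∷ʳ a) (reverse rv)) (F ∘ (_∷ʳ b)) + Σ₊)
    ≡⟨ ∑-harm-∷ʳ (reverse ru) (reverse rv) a b F ⟨
  ∑ (harm (reverse ru ∷ʳ a) (reverse rv ∷ʳ b)) F
    ≡⟨ cong₂ (λ u v → ∑ (harm u v) F) (List.unfold-reverse a ru) (List.unfold-reverse b rv) ⟨
  ∑ (harm (reverse (a ∷ ru)) (reverse (b ∷ rv))) F ∎
  where
  Σ₊ : ℚ
  Σ₊ = ∑ (harm (reverse ru) (reverse rv)) (F ∘ (_∷ʳ (a ℕ.+ b)))
  last-letter : ∀ c su sv →
    ∑[ w ∈ harmRev su sv ] F (reverse (c ∷ w)) ≡ ∑ (harm (reverse su) (reverse sv)) (F ∘ (_∷ʳ c))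
  last-letter c su sv = trans (∑-cong (harmRev su sv) λ w → cong F (List.unfold-reverse c w))
                              (∑-harmRev su sv (F ∘ (_∷ʳ c)))

∑-harmWord : ∀ u v (F : List ℕ → ℚ) → ∑ (harmWord u v) F ≡ ∑ (harm u v) F
∑-harmWord u v F = begin
  ∑ (map reverse (harmRev (reverse u) (reverse v))) F
    ≡⟨ ∑-map reverse (harmRev (reverse u) (reverse v)) F ⟩
  ∑ (harmRev (reverse u) (reverse v)) (F ∘ reverse)
    ≡⟨ ∑-harmRev (reverse u) (reverse v) F ⟩
  ∑ (harm (reverse (reverse u)) (reverse (reverse v))) F
    ≡⟨ cong₂ (λ u v → ∑ (harm u v) F) (List.reverse-involutive u) (List.reverse-involutive v) ⟩
  ∑ (harm u v) F ∎

choices : ℕ → List Letter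
choices k = if k ℕ.≡ᵇ 1 then strict k ∷ weak ∷ [] else strict k ∷ []

expand : List ℕ → List (List Letter)
expand []       = [] ∷ []
expand (k ∷ ks) = concatMap (λ x → map (_∷ x) (choices k)) (expand ks)

∑-expand-∷ : ∀ k ks (G : List Letter → ℚ) →
             ∑ (expand (k ∷ ks)) G ≡ ∑[ x ∈ expand ks ] ∑[ l ∈ choices k ] G (l ∷ x)
∑-expand-∷ k ks G =
  trans (∑-concatMap _ (expand ks) G) (∑-cong (expand ks) λ x → ∑-map (_∷ x) (choices k) G)

choices-≥2 : ∀ {k} → 2 ≤ k → choices k ≡ strict k ∷ []
choices-≥2 (s≤s (s≤s _)) = refl

expand-≥2 : ∀ {v} → All (2 ≤_) v → expand v ≡ map strict v ∷ []
expand-≥2 []                  = refl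
expand-≥2 {k ∷ v} (k≥2 ∷ v≥2) rewrite expand-≥2 v≥2 | choices-≥2 k≥2 = refl

∑-expand-≥2 : ∀ {k} ks (G : List Letter → ℚ) → 2 ≤ k →
              ∑ (expand (k ∷ ks)) G ≡ ∑[ x ∈ expand ks ] G (strict k ∷ x)
∑-expand-≥2 {k} ks G k≥2 = trans (∑-expand-∷ k ks G) (∑-cong (expand ks) λ x →
  trans (cong (λ ls → ∑[ l ∈ ls ] G (l ∷ x)) (choices-≥2 k≥2)) (ℚ.+-identityʳ _))

∑-choices-⊛ : ∀ a x b v (G : List Letter → ℚ) →
  ∑[ l ∈ choices a ] ∑ ((l ∷ x) ⊛ (b ∷ v)) G ≡
  ∑[ l ∈ choices a ] ∑[ y ∈ x ⊛ (b ∷ v) ] G (l ∷ y)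
    + (∑[ l ∈ choices a ] ∑[ y ∈ (l ∷ x) ⊛ v ] G (strict b ∷ y) + ∑[ y ∈ x ⊛ v ] G (strict (a ℕ.+ b) ∷ y))
∑-choices-⊛ a x b v G with a ℕ.≡ᵇ 1
... | true = begin
  ∑ ((strict a ∷ x) ⊛ (b ∷ v)) G + (∑ ((weak ∷ x) ⊛ (b ∷ v)) G + 0ℚ)
    ≡⟨ cong₂ (λ s t → s + (t + 0ℚ)) (∑-strict-⊛ a x b v G) (∑-weak-⊛ x b v G) ⟩
  (p + (r + t)) + ((q + s) + 0ℚ)
    ≡⟨ rearrange p q r s t ⟩
  (p + (q + 0ℚ)) + ((r + (s + 0ℚ)) + t) ∎
  where
  p q r s t : ℚ
  p = ∑[ y ∈ x ⊛ (b ∷ v) ] G (strict a ∷ y)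
  q = ∑[ y ∈ x ⊛ (b ∷ v) ] G (weak ∷ y)
  r = ∑[ y ∈ (strict a ∷ x) ⊛ v ] G (strict b ∷ y)
  s = ∑[ y ∈ (weak ∷ x) ⊛ v ] G (strict b ∷ y)
  t = ∑[ y ∈ x ⊛ v ] G (strict (a ℕ.+ b) ∷ y)
  rearrange : ∀ p q r s t → (p + (r + t)) + ((q + s) + 0ℚ) ≡ (p + (q + 0ℚ)) + ((r + (s + 0ℚ)) + t)
  rearrange = solve-∀ ℚ-ring
... | false = begin
  ∑ ((strict a ∷ x) ⊛ (b ∷ v)) G + 0ℚ
    ≡⟨ cong (_+ 0ℚ) (∑-strict-⊛ a x b v G) ⟩
  (p + (r + t)) + 0ℚ
    ≡⟨ rearrange p r t ⟩
  (p + 0ℚ) + ((r + 0ℚ) + t) ∎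
  where
  p r t : ℚ
  p = ∑[ y ∈ x ⊛ (b ∷ v) ] G (strict a ∷ y)
  r = ∑[ y ∈ (strict a ∷ x) ⊛ v ] G (strict b ∷ y)
  t = ∑[ y ∈ x ⊛ v ] G (strict (a ℕ.+ b) ∷ y)
  rearrange : ∀ p r t → (p + (r + t)) + 0ℚ ≡ (p + 0ℚ) + ((r + 0ℚ) + t)
  rearrange = solve-∀ ℚ-ring

∑-harm-expand : ∀ u v → All (2 ≤_) v → (G : List Letter → ℚ) →
  ∑[ w ∈ harm u v ] ∑ (expand w) G ≡ ∑[ x ∈ expand u ] ∑ (x ⊛ v) G
∑-harm-expand []      v       v≥2 G rewrite expand-≥2 v≥2 = refl
∑-harm-expand (a ∷ u) []      _   G = trans (ℚ.+-identityʳ _) (∑-cong (expand (a ∷ u)) λ x →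
  sym (trans (cong (λ P → ∑ P G) (⊛-[] x)) (ℚ.+-identityʳ (G x))))
∑-harm-expand (a ∷ u) (b ∷ v) (b≥2 ∷ v≥2) G = begin
  ∑[ w ∈ harm (a ∷ u) (b ∷ v) ] ∑ (expand w) G
    ≡⟨ ∑-harm-∷ a u b v (λ w → ∑ (expand w) G) ⟩
  ∑[ w ∈ harm u (b ∷ v) ] ∑ (expand (a ∷ w)) G
    + (∑[ w ∈ harm (a ∷ u) v ] ∑ (expand (b ∷ w)) G + ∑[ w ∈ harm u v ] ∑ (expand ((a ℕ.+ b) ∷ w)) G)
    ≡⟨ cong₂ _+_ (∑-cong (harm u (b ∷ v)) λ w → ∑-expand-∷ a w G)
                 (cong₂ _+_ (∑-cong (harm (a ∷ u) v) λ w → ∑-expand-≥2 w G b≥2)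
                            (∑-cong (harm u v) λ w → ∑-expand-≥2 w G a+b≥2)) ⟩
  ∑[ w ∈ harm u (b ∷ v) ] ∑ (expand w) Gₐ
    + (∑[ w ∈ harm (a ∷ u) v ] ∑ (expand w) Gᵦ + ∑[ w ∈ harm u v ] ∑ (expand w) Gₐ₊ᵦ)
    ≡⟨ cong₂ _+_ (∑-harm-expand u (b ∷ v) (b≥2 ∷ v≥2) Gₐ)
                 (cong₂ _+_ (∑-harm-expand (a ∷ u) v v≥2 Gᵦ) (∑-harm-expand u v v≥2 Gₐ₊ᵦ)) ⟩
  ∑ (expand u) Hₐ + (∑[ x ∈ expand (a ∷ u) ] ∑ (x ⊛ v) Gᵦ + ∑ (expand u) Hₐ₊ᵦ)
    ≡⟨ cong (λ s → ∑ (expand u) Hₐ + (s + ∑ (expand u) Hₐ₊ᵦ)) (∑-expand-∷ a u (λ x → ∑ (x ⊛ v) Gᵦ)) ⟩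
  ∑ (expand u) Hₐ + (∑ (expand u) Hᵦ + ∑ (expand u) Hₐ₊ᵦ)
    ≡⟨ trans (∑-+ (expand u) Hₐ _) (cong (∑ (expand u) Hₐ +_) (∑-+ (expand u) Hᵦ Hₐ₊ᵦ)) ⟨
  ∑[ x ∈ expand u ] (Hₐ x + (Hᵦ x + Hₐ₊ᵦ x))
    ≡⟨ ∑-cong (expand u) (λ x →
         trans (cong (_+ (Hᵦ x + Hₐ₊ᵦ x)) (∑-comm (x ⊛ (b ∷ v)) (choices a) λ y l → G (l ∷ y)))
               (sym (∑-choices-⊛ a x b v G))) ⟩
  ∑[ x ∈ expand u ] ∑[ l ∈ choices a ] ∑ ((l ∷ x) ⊛ (b ∷ v)) G
    ≡⟨ ∑-expand-∷ a u (λ x → ∑ (x ⊛ (b ∷ v)) G) ⟨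
  ∑[ x ∈ expand (a ∷ u) ] ∑ (x ⊛ (b ∷ v)) G ∎
  where
  a+b≥2 : 2 ≤ a ℕ.+ b
  a+b≥2 = ℕ.≤-trans b≥2 (ℕ.m≤n+m b a)
  Gₐ Gᵦ Gₐ₊ᵦ : List Letter → ℚ
  Gₐ x = ∑[ l ∈ choices a ] G (l ∷ x)
  Gᵦ = G ∘ (strict b ∷_)
  Gₐ₊ᵦ = G ∘ (strict (a ℕ.+ b) ∷_)
  Hₐ Hᵦ Hₐ₊ᵦ : List Letter → ℚ
  Hₐ x = ∑ (x ⊛ (b ∷ v)) Gₐ
  Hᵦ x = ∑[ l ∈ choices a ] ∑ ((l ∷ x) ⊛ v) Gᵦ
  Hₐ₊ᵦ x = ∑ (x ⊛ v) Gₐ₊ᵦ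

interval : ℕ → ℕ → List ℕ
interval s zero    = []
interval s (suc m) = s ∷ interval (suc s) m

map-suc-upTo : ∀ m → map suc (upTo m) ≡ interval 1 m
map-suc-upTo m = trans (List.map-upTo suc m) (shifted suc 1 m λ _ → refl)
  where
  shifted : ∀ (f : ℕ → ℕ) s m → (∀ i → f i ≡ s ℕ.+ i) → applyUpTo f m ≡ interval s m
  shifted f s zero    _  = refl
  shifted f s (suc m) f≗ = cong₂ _∷_ (trans (f≗ 0) (ℕ.+-identityʳ s))
                                     (shifted (f ∘ suc) (suc s) m λ i → trans (f≗ (suc i)) (ℕ.+-suc s i))

∑-interval-restrict-all : ∀ {L s} m (F : ℕ → ℚ) → L ≤ s →
  ∑[ n ∈ interval s m ] [ L ℕ.≤ᵇ n ]· F n ≡ ∑ (interval s m) F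
∑-interval-restrict-all zero    F _   = refl
∑-interval-restrict-all (suc m) F L≤s =
  cong₂ _+_ ([]·-true _ (ℕ.≤⇒≤ᵇ L≤s)) (∑-interval-restrict-all m F (ℕ.m≤n⇒m≤1+n L≤s))

∑-interval-restrict : ∀ {s L} m k (F : ℕ → ℚ) → s ℕ.+ m ≡ L ℕ.+ k → s ≤ L →
  ∑[ n ∈ interval s m ] [ L ℕ.≤ᵇ n ]· F n ≡ ∑ (interval L k) F
∑-interval-restrict         zero    zero    F _ _   = refl
∑-interval-restrict {s} {L} zero    (suc k) F e s≤L =
  ⊥-elim (ℕ.m+1+n≰m L (subst (_≤ L) (trans (sym (ℕ.+-identityʳ s)) e) s≤L))
∑-interval-restrict {s} {L} (suc m) k       F e s≤L with ℕ.m≤n⇒m<n∨m≡n s≤L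
... | inj₁ s<L = trans (cong₂ _+_ ([]·-false _ λ L≤s → ℕ.<⇒≱ s<L (ℕ.≤ᵇ⇒≤ L s L≤s))
                                  (∑-interval-restrict m k F (trans (sym (ℕ.+-suc s m)) e) s<L))
                       (ℚ.+-identityˡ _)
... | inj₂ refl with ℕ.+-cancelˡ-≡ s (suc m) k e
...   | refl = cong₂ _+_ ([]·-true {s ℕ.≤ᵇ s} (F s) (ℕ.≤⇒≤ᵇ (ℕ.≤-refl {s})))
                         (∑-interval-restrict-all m F (ℕ.n≤1+n s))

-- (+ 1) / suc m unfolds to fromℚᵘ (mkℚᵘ (+ 1) m), so the identity can be checked in ℚᵘ,
-- where products are not normalised.
inv-* : ∀ m n → inv (m ℕ.* n) ≡ inv m * inv n
inv-* zero    n       = sym (ℚ.*-zeroˡ (inv n))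
inv-* (suc m) zero    = trans (cong inv (ℕ.*-zeroʳ (suc m))) (sym (ℚ.*-zeroʳ (inv (suc m))))
inv-* (suc m) (suc n) = ℚ.toℚᵘ-injective
  (ℚᵘ.≃-trans (ℚ.toℚᵘ-fromℚᵘ (mkℚᵘ (ℤ.+ 1) (n ℕ.+ m ℕ.* suc n)))
    (ℚᵘ.≃-sym (ℚᵘ.≃-trans (ℚ.toℚᵘ-homo-* (inv (suc m)) (inv (suc n)))
      (ℚᵘ.*-cong (ℚ.toℚᵘ-fromℚᵘ (mkℚᵘ (ℤ.+ 1) m)) (ℚ.toℚᵘ-fromℚᵘ (mkℚᵘ (ℤ.+ 1) n))))))

inv-^-+ : ∀ a b n → inv (n ^ (a ℕ.+ b)) ≡ inv (n ^ a) * inv (n ^ b)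
inv-^-+ a b n = trans (cong inv (ℕ.^-distribˡ-+-* n a b)) (inv-* (n ^ a) (n ^ b))

head≥ᵇ : ℕ → List ℕ → Bool
head≥ᵇ L []      = true
head≥ᵇ L (n ∷ _) = L ℕ.≤ᵇ n

letter : Bool → ℕ → Letter
letter false k = strict k
letter true  k = weak

encode : List ℕ → List Bool → List Letter
encode (k ∷ ks) (a ∷ A) = letter a k ∷ encode ks A
encode _        _       = []

next : Letter → ℕ → ℕ
next (strict _) n = suc n
next weak       n = n

inS-∷ : ∀ a k A n t → inS (a ∷ A) (n ∷ t) ≡ head≥ᵇ (next (letter a k) n) t ∧ inS A t
inS-∷ a     k []      n []      = refl
inS-∷ a     k (_ ∷ _) n []      = refl
inS-∷ false k A       n (_ ∷ _) = refl
inS-∷ true  k A       n (_ ∷ _) = refl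

∑-subsets : ∀ ks (G : List Bool → ℚ) (H : List Letter → ℚ) →
            (∀ A → length A ≡ length ks → G A ≡ H (encode ks A)) → ∑ (subsets ks) G ≡ ∑ (expand ks) H
∑-subsets []       G H G≗H = cong (_+ 0ℚ) (G≗H [] refl)
∑-subsets (k ∷ ks) G H G≗H = begin
  ∑ (subsets (k ∷ ks)) G
    ≡⟨ ∑-concatMap _ (subsets ks) G ⟩
  ∑[ A ∈ subsets ks ] ∑ (if k ℕ.≡ᵇ 1 then (false ∷ A) ∷ (true ∷ A) ∷ [] else (false ∷ A) ∷ []) G
    ≡⟨ ∑-subsets ks _ _ (λ A ∣A∣ → extend A ∣A∣ (k ℕ.≡ᵇ 1)) ⟩
  ∑[ x ∈ expand ks ] ∑[ l ∈ choices k ] H (l ∷ x)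
    ≡⟨ ∑-expand-∷ k ks H ⟨
  ∑ (expand (k ∷ ks)) H ∎
  where
  extend : ∀ A → length A ≡ length ks → ∀ b →
    ∑ (if b then (false ∷ A) ∷ (true ∷ A) ∷ [] else (false ∷ A) ∷ []) G ≡
    ∑[ l ∈ (if b then strict k ∷ weak ∷ [] else strict k ∷ []) ] H (l ∷ encode ks A)
  extend A ∣A∣ true  = cong₂ _+_ (G≗H (false ∷ A) (cong suc ∣A∣))
                                 (cong (_+ 0ℚ) (G≗H (true ∷ A) (cong suc ∣A∣)))
  extend A ∣A∣ false = cong (_+ 0ℚ) (G≗H (false ∷ A) (cong suc ∣A∣))

module _ (N : ℕ) where

  indices : List ℕ
  indices = map suc (upTo (N ∸ 1))

  tailSum : ℕ → (ℕ → ℚ) → ℚ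
  tailSum L F = ∑[ n ∈ indices ] [ L ℕ.≤ᵇ n ]· F n

  tailSum-interval : ∀ {L k} (F : ℕ → ℚ) → 1 ≤ L → L ℕ.+ k ≡ N → tailSum L F ≡ ∑ (interval L k) F
  tailSum-interval {L} {k} F 1≤L L+k≡N = begin
    tailSum L F
      ≡⟨ cong (λ ns → ∑[ n ∈ ns ] [ L ℕ.≤ᵇ n ]· F n) (map-suc-upTo (N ∸ 1)) ⟩
    ∑[ n ∈ interval 1 (N ∸ 1) ] [ L ℕ.≤ᵇ n ]· F n
      ≡⟨ ∑-interval-restrict (N ∸ 1) k F (trans (ℕ.m+[n∸m]≡n 1≤N) (sym L+k≡N)) 1≤L ⟩
    ∑ (interval L k) F ∎
    where
    1≤N : 1 ≤ N
    1≤N = ℕ.≤-trans 1≤L (subst (L ≤_) L+k≡N (ℕ.m≤m+n L k))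

  tailSum-0 : ∀ F → tailSum 0 F ≡ tailSum 1 F
  tailSum-0 F = sym (begin
    tailSum 1 F
      ≡⟨ cong (λ ns → ∑[ n ∈ ns ] [ 1 ℕ.≤ᵇ n ]· F n) (map-suc-upTo (N ∸ 1)) ⟩
    ∑[ n ∈ interval 1 (N ∸ 1) ] [ 1 ℕ.≤ᵇ n ]· F n
      ≡⟨ ∑-interval-restrict-all (N ∸ 1) F ℕ.≤-refl ⟩
    ∑ (interval 1 (N ∸ 1)) F
      ≡⟨ cong (λ ns → ∑ ns F) (map-suc-upTo (N ∸ 1)) ⟨
    tailSum 0 F ∎)

  letterWeight : Letter → ℕ → ℚ
  letterWeight (strict k) n = inv (n ^ k)
  letterWeight weak       n = inv (N ∸ n)

  nestedFrom : List Letter → ℕ → ℚ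
  nestedFrom []      L = 1ℚ
  nestedFrom (l ∷ x) L = tailSum L (λ n → letterWeight l n * nestedFrom x (next l n))

  nestedFrom-∷ : ∀ {L k} l x → 1 ≤ L → L ℕ.+ suc k ≡ N →
    nestedFrom (l ∷ x) L ≡ letterWeight l L * nestedFrom x (next l L) + nestedFrom (l ∷ x) (suc L)
  nestedFrom-∷ {L} {k} l x 1≤L L+k≡N =
    trans (tailSum-interval F 1≤L L+k≡N)
          (cong (F L +_) (sym (tailSum-interval F (s≤s z≤n) (trans (sym (ℕ.+-suc L k)) L+k≡N))))
    where
    F : ℕ → ℚ
    F n = letterWeight l n * nestedFrom x (next l n)

  open NestedSum (λ k n → inv (n ^ k)) (λ n → inv (N ∸ n))

  nestedFrom-interval : ∀ x L k → 1 ≤ L → L ℕ.+ k ≡ N → nestedFrom x L ≡ nested x (interval L k)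
  nestedFrom-interval []             L k       _   _ = refl
  nestedFrom-interval (_ ∷ _)        L zero    1≤L e = tailSum-interval _ 1≤L e
  nestedFrom-interval (strict a ∷ x) L (suc k) 1≤L e =
    trans (nestedFrom-∷ (strict a) x 1≤L e)
          (cong₂ _+_ (cong (inv (L ^ a) *_) (nestedFrom-interval x (suc L) k (s≤s z≤n) e′))
                     (nestedFrom-interval (strict a ∷ x) (suc L) k (s≤s z≤n) e′))
    where
    e′ : suc L ℕ.+ k ≡ N
    e′ = trans (sym (ℕ.+-suc L k)) e
  nestedFrom-interval (weak ∷ x)     L (suc k) 1≤L e =
    trans (nestedFrom-∷ weak x 1≤L e)
          (cong₂ _+_ (cong (inv (N ∸ L) *_) (nestedFrom-interval x L (suc k) 1≤L e))
                     (nestedFrom-interval (weak ∷ x) (suc L) k (s≤s z≤n) e′))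
    where
    e′ : suc L ℕ.+ k ≡ N
    e′ = trans (sym (ℕ.+-suc L k)) e

  ∑-tuples-suc : ∀ r (G : List ℕ → ℚ) →
    ∑ (tuples (suc r) N) G ≡ ∑[ n ∈ indices ] ∑[ t ∈ tuples r N ] G (n ∷ t)
  ∑-tuples-suc r G =
    trans (∑-concatMap _ (tuples r N) G)
          (trans (∑-cong (tuples r N) λ t → ∑-map (_∷ t) indices G)
                 (∑-comm (tuples r N) indices _))

  weight-∷ : ∀ k ks a A n t →
    weight N (k ∷ ks) (a ∷ A) (n ∷ t) ≡ letterWeight (letter a k) n * weight N ks A t
  weight-∷ k ks false A n t = refl
  weight-∷ k ks true  A n t = refl

  ∑-tuples-from : ∀ ks A L → length A ≡ length ks →
    ∑[ t ∈ tuples (length ks) N ] [ head≥ᵇ L t ∧ inS A t ]· weight N ks A t ≡ nestedFrom (encode ks A) L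
  ∑-tuples-from []       []      L _   = ℚ.+-identityʳ 1ℚ
  ∑-tuples-from (k ∷ ks) (a ∷ A) L ∣A∣ = begin
    ∑[ t ∈ tuples (suc (length ks)) N ] [ head≥ᵇ L t ∧ inS (a ∷ A) t ]· weight N (k ∷ ks) (a ∷ A) t
      ≡⟨ ∑-tuples-suc (length ks) _ ⟩
    ∑[ n ∈ indices ] ∑[ t ∈ Ts ] [ (L ℕ.≤ᵇ n) ∧ inS (a ∷ A) (n ∷ t) ]· weight N (k ∷ ks) (a ∷ A) (n ∷ t)
      ≡⟨ ∑-cong indices first-index ⟩
    tailSum L (λ n → w n * ∑[ t ∈ Ts ] [ head≥ᵇ (next l n) t ∧ inS A t ]· weight N ks A t)
      ≡⟨ ∑-cong indices (λ n → cong (λ q → [ L ℕ.≤ᵇ n ]· (w n * q))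
                                     (∑-tuples-from ks A (next l n) (ℕ.suc-injective ∣A∣))) ⟩
    nestedFrom (l ∷ encode ks A) L ∎
    where
    Ts : List (List ℕ)
    Ts = tuples (length ks) N
    l : Letter
    l = letter a k
    w : ℕ → ℚ
    w = letterWeight l
    first-index : ∀ n →
      ∑[ t ∈ Ts ] [ (L ℕ.≤ᵇ n) ∧ inS (a ∷ A) (n ∷ t) ]· weight N (k ∷ ks) (a ∷ A) (n ∷ t) ≡
      [ L ℕ.≤ᵇ n ]· (w n * ∑[ t ∈ Ts ] [ head≥ᵇ (next l n) t ∧ inS A t ]· weight N ks A t)
    first-index n = begin
      ∑[ t ∈ Ts ] [ (L ℕ.≤ᵇ n) ∧ inS (a ∷ A) (n ∷ t) ]· weight N (k ∷ ks) (a ∷ A) (n ∷ t)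
        ≡⟨ ∑-cong Ts (λ t → cong₂ (λ b q → [ (L ℕ.≤ᵇ n) ∧ b ]· q)
                                  (inS-∷ a k A n t) (weight-∷ k ks a A n t)) ⟩
      ∑[ t ∈ Ts ] [ (L ℕ.≤ᵇ n) ∧ (head≥ᵇ (next l n) t ∧ inS A t) ]· (w n * weight N ks A t)
        ≡⟨ ∑-cong Ts (λ t → []·-∧-* (L ℕ.≤ᵇ n) _ (w n) _) ⟩
      ∑[ t ∈ Ts ] [ L ℕ.≤ᵇ n ]· (w n * [ head≥ᵇ (next l n) t ∧ inS A t ]· weight N ks A t)
        ≡⟨ ∑-[]· Ts (L ℕ.≤ᵇ n) _ ⟩
      [ L ℕ.≤ᵇ n ]· ∑[ t ∈ Ts ] (w n * [ head≥ᵇ (next l n) t ∧ inS A t ]· weight N ks A t)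
        ≡⟨ cong ([ L ℕ.≤ᵇ n ]·_) (∑-*ˡ Ts (w n) _) ⟩
      [ L ℕ.≤ᵇ n ]· (w n * ∑[ t ∈ Ts ] [ head≥ᵇ (next l n) t ∧ inS A t ]· weight N ks A t) ∎

  ζ♢-nestedFrom : ∀ ks → ζ♢ ks N ≡ ∑[ x ∈ expand ks ] nestedFrom x 0
  ζ♢-nestedFrom ks = begin
    ζ♢ ks N
      ≡⟨ sumℚ-concatMap _ (subsets ks) ⟩
    ∑[ A ∈ subsets ks ] sumℚ (concatMap (term A) (tuples (length ks) N))
      ≡⟨ ∑-subsets ks _ _ (λ A ∣A∣ → trans (sumℚ-concatMap (term A) (tuples (length ks) N))
                                          (trans (∑-cong (tuples (length ks) N) (sumℚ-term A))
                                                 (∑-tuples-from ks A 0 ∣A∣))) ⟩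
    ∑[ x ∈ expand ks ] nestedFrom x 0 ∎
    where
    term : List Bool → List ℕ → List ℚ
    term A t = if inS A t then weight N ks A t ∷ [] else []
    sumℚ-term : ∀ A t → sumℚ (term A t) ≡ [ head≥ᵇ 0 t ∧ inS A t ]· weight N ks A t
    sumℚ-term A []      with inS A []
    ... | true  = ℚ.+-identityʳ _
    ... | false = refl
    sumℚ-term A (n ∷ t) with inS A (n ∷ t)
    ... | true  = ℚ.+-identityʳ _
    ... | false = refl

  module _ (1≤N : 1 ≤ N) where

    Zword-nested : ∀ w → Zword w N ≡ ∑[ x ∈ expand w ] nested x (interval 1 (N ∸ 1))
    Zword-nested []        = sym (ℚ.+-identityʳ 1ℚ)
    Zword-nested w@(_ ∷ _) = trans (ζ♢-nestedFrom w) (∑-cong (expand w) nestedFrom-0)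
      where
      nestedFrom-0 : ∀ x → nestedFrom x 0 ≡ nested x (interval 1 (N ∸ 1))
      nestedFrom-0 []      = refl
      nestedFrom-0 (l ∷ x) =
        trans (tailSum-0 _) (nestedFrom-interval (l ∷ x) 1 (N ∸ 1) ℕ.≤-refl (ℕ.m+[n∸m]≡n 1≤N))

    Zword-harmWord : ∀ u v → InH≥2 v → ∑[ w ∈ harmWord u v ] Zword w N ≡ Zword u N * Zword v N
    Zword-harmWord u v v≥2 = begin
      ∑[ w ∈ harmWord u v ] Zword w N
        ≡⟨ ∑-harmWord u v _ ⟩
      ∑[ w ∈ harm u v ] Zword w N
        ≡⟨ ∑-cong (harm u v) Zword-nested ⟩
      ∑[ w ∈ harm u v ] ∑[ x ∈ expand w ] nested x C
        ≡⟨ ∑-harm-expand u v v≥2 _ ⟩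
      ∑[ x ∈ expand u ] ∑[ y ∈ x ⊛ v ] nested y C
        ≡⟨ ∑-cong (expand u) (λ x → nested-⊛ inv-^-+ C x v) ⟨
      ∑[ x ∈ expand u ] (nested x C * nested (map strict v) C)
        ≡⟨ ∑-*ʳ (expand u) _ _ ⟩
      ∑[ x ∈ expand u ] nested x C * nested (map strict v) C
        ≡⟨ cong₂ _*_ (Zword-nested u) v-nested ⟨
      Zword u N * Zword v N ∎
      where
      C : List ℕ
      C = interval 1 (N ∸ 1)
      v-nested : Zword v N ≡ nested (map strict v) C
      v-nested = trans (Zword-nested v)
                       (trans (cong (λ P → ∑[ x ∈ P ] nested x C) (expand-≥2 v≥2)) (ℚ.+-identityʳ _))

  Z♢-∗ : ∀ p q → (∀ u v → InH≥2 v → ∑[ w ∈ harmWord u v ] Zword w N ≡ Zword u N * Zword v N) →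
         InH≥2-poly q → Z♢ (p ∗ q) N ≡ Z♢ p N * Z♢ q N
  Z♢-∗ p q multiplicative q≥2 =
    trans (∑-concatMap _ p term) (trans (∑-cong p λ { (c , u) → row c u }) (∑-*ʳ p _ term))
    where
    term : ℚ × Word → ℚ
    term (c , w) = c * Zword w N
    row : ∀ c u → ∑ (concatMap (λ { (d , v) → map (λ w → (c * d , w)) (harmWord u v) }) q) term ≡
                  term (c , u) * ∑ q term
    row c u = trans (∑-concatMap _ q term)
                    (trans (∑-cong-All q≥2 λ { (d , v) v≥2 → entry d v v≥2 }) (∑-*ˡ q (term (c , u)) term))
      where
      entry : ∀ d v → InH≥2 v → ∑ (map (λ w → (c * d , w)) (harmWord u v)) term ≡ term (c , u) * term (d , v)
      entry d v v≥2 = begin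
        ∑ (map (λ w → (c * d , w)) (harmWord u v)) term
          ≡⟨ ∑-map _ (harmWord u v) term ⟩
        ∑[ w ∈ harmWord u v ] ((c * d) * Zword w N)
          ≡⟨ ∑-*ˡ (harmWord u v) (c * d) _ ⟩
        (c * d) * ∑[ w ∈ harmWord u v ] Zword w N
          ≡⟨ cong ((c * d) *_) (multiplicative u v v≥2) ⟩
        (c * d) * (Zword u N * Zword v N)
          ≡⟨ *-interchange c d (Zword u N) (Zword v N) ⟩
        (c * Zword u N) * (d * Zword v N) ∎

proposition3p1 : (w₁ w₂ : Poly) → InH0-poly w₁ → InH≥2-poly w₂ →
    (N : ℕ) → 1 ≤ N → Z♢ (w₁ ∗ w₂) N ≡ Z♢ w₁ N * Z♢ w₂ N
proposition3p1 w₁ w₂ _ w₂∈H≥2 N 1≤N = Z♢-∗ N w₁ w₂ (Zword-harmWord N 1≤N) w₂∈H≥2
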